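{- Let $G$ be a finite simple graph with maximum degree $\Delta(G)\ge 3$, let $v_1,v_2$ be adjacent vertices of $G$, and let $K=N_G[v_1]\cap N_G[v_2]$. If $G-\{v_1,v_2\}$ is odd $m$-colorable for some integer $m\ge 2\Delta(G)-|K|+\left\lceil \frac{3}{2}+\sqrt{2|K|-3}\right\rceil$, then $G$ is odd $m$-colorable.
   Context: $N_G[v]$ denotes the closed neighborhood $N_G(v)\cup\{v\}$. An odd $m$-coloring of a graph is a proper coloring with colors from $\{1,\dots,m\}$ such that every vertex of positive degree has some color appearing an odd number of times on its neighborhood. A graph is odd $m$-colorable if it has an odd $m$-coloring. -}

module Defs where

open import Data.Nat using (ℕ; zero; suc; _+_; _*_; _∸_; _≤_; _<_; _≤ᵇ_; _⊔_; _%_)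
open import Data.Bool using (Bool; true; false; _∧_; _∨_; if_then_else_)
open import Data.Fin using (Fin; _≟_)
open import Data.List using (List; length; filter; map; foldr; allFin)
open import Data.Product using (Σ; ∃; _×_)
open import Relation.Binary.PropositionalEquality using (_≡_; _≢_)
open import Relation.Nullary.Decidable using (⌊_⌋)
open import Relation.Unary using (Pred)

record Graph (n : ℕ) : Set where
  field
    adj   : Fin n → Fin n → Bool
    sym   : ∀ u v → adj u v ≡ adj v u
    irrefl : ∀ v → adj v v ≡ false
open Graph public

countV : {n : ℕ} → (Fin n → Bool) → ℕ
countV {n} p = length (filter (λ u → p u Data.Bool.≟ true) (allFin n))

deg : {n : ℕ} → Graph n → Fin n → ℕ
deg G v = countV (adj G v)

maxDeg : {n : ℕ} → Graph n → ℕ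
maxDeg {n} G = foldr _⊔_ 0 (map (deg G) (allFin n))

eqᵇ : {n : ℕ} → Fin n → Fin n → Bool
eqᵇ u v = ⌊ u ≟ v ⌋

closedNbhd : {n : ℕ} → Graph n → Fin n → Fin n → Bool
closedNbhd G v u = eqᵇ u v ∨ adj G v u

commonClosed : {n : ℕ} → Graph n → Fin n → Fin n → ℕ
commonClosed G v₁ v₂ = countV (λ u → closedNbhd G v₁ u ∧ closedNbhd G v₂ u)

-- Odd colouring of the induced subgraph G[S] (S a vertex subset given as a
-- boolean predicate), with colours Fin m (standing for {1,…,m}).
-- The colouring is a function on all vertices; its values outside S are irrelevant.
degIn : {n : ℕ} → Graph n → (Fin n → Bool) → Fin n → ℕ
degIn G S v = countV (λ u → S u ∧ adj G v u)

colourCountIn : {n m : ℕ} → Graph n → (Fin n → Bool) → (Fin n → Fin m) → Fin n → Fin m → ℕ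
colourCountIn G S c v i = countV (λ u → S u ∧ adj G v u ∧ eqᵇ (c u) i)

IsOddColouringOn : {n : ℕ} → Graph n → (Fin n → Bool) → (m : ℕ) → (Fin n → Fin m) → Set
IsOddColouringOn G S m c =
  (∀ u v → S u ≡ true → S v ≡ true → adj G u v ≡ true → c u ≢ c v)
  × (∀ v → S v ≡ true → 0 < degIn G S v →
       ∃ λ (i : Fin m) → colourCountIn G S c v i % 2 ≡ 1)

OddColourableOn : {n : ℕ} → Graph n → (Fin n → Bool) → ℕ → Set
OddColourableOn G S m = ∃ λ (c : Fin _ → Fin m) → IsOddColouringOn G S m c

OddColourable : {n : ℕ} → Graph n → ℕ → Set
OddColourable G m = OddColourableOn G (λ _ → true) m

OddColourableMinus2 : {n : ℕ} → Graph n → Fin n → Fin n → ℕ → Set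
OddColourableMinus2 G v₁ v₂ m =
  OddColourableOn G (λ u → Data.Bool.not (eqᵇ u v₁ ∨ eqᵇ u v₂)) m

-- ⌈ 3/2 + √x ⌉ for a natural number x, computed exactly without reals:
-- it is the least natural c with c ≥ 3/2 + √x, i.e. with 2c ≥ 3 and
-- 4x ≤ (2c − 3)².  The search starts at 0 and c = x + 2 always qualifies,
-- so fuel x + 3 suffices.
threeHalvesOK : ℕ → ℕ → Bool
threeHalvesOK x c = (3 ≤ᵇ 2 * c) ∧ (4 * x ≤ᵇ (2 * c ∸ 3) * (2 * c ∸ 3))

searchFrom : ℕ → ℕ → ℕ → ℕ
searchFrom x zero c = c
searchFrom x (suc f) c = if threeHalvesOK x c then c else searchFrom x f (suc c)

ceilThreeHalvesPlusSqrt : ℕ → ℕ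
ceilThreeHalvesPlusSqrt x = searchFrom x (x + 3) 0

-- Colour v₁ with a and v₂ with b and keep the given colouring c′ of G − {v₁, v₂} elsewhere.
-- Properness asks a (resp. b) to avoid the colours of the other neighbours of v₁ (resp. v₂).
-- A vertex adjacent to only one of v₁, v₂ (v₂ and v₁ themselves included) loses its odd colour
-- only if that colour was its unique odd colour and the new colour equals it, so it forbids at
-- most one colour.  A common neighbour loses all odd colours only if its odd colours were exactly
-- {a, b}, so it forbids at most one pair; with t = |K| − 2 common neighbours these pairs are the
-- t edges of a multigraph on the colours.  Hence each of a, b has at most 2Δ − t − 1 forbidden
-- colours, leaving at least p = ⌈3/2 + √(2|K| − 3)⌉ − 1 free ones, and p(p − 1) > 2t.  Fewer
-- than p colours have degree ≥ p − 1 in the multigraph, so a can be chosen free and of degree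
-- < p − 1, and then b free and different from a and from all neighbours of a.

module Submission where

open import Defs hiding (sym)
open import Data.Bool using (Bool; true; false; _∧_; _∨_; not; if_then_else_; T)
import Data.Bool as Bool
open import Data.Bool.Properties using (T-∧; T-≡; ¬-not; ∧-comm)
open import Data.Empty using (⊥-elim)
open import Data.Fin using (Fin; zero; suc; _≟_)
open import Data.Fin.Properties using (any?; ¬∀⟶∃¬; pigeonhole; suc-injective; <⇒≢; 0≢1+n)
open import Data.List
  using (List; []; _∷_; _++_; length; map; filter; foldr; allFin; tabulate; lookup; mapMaybe)
open import Data.List.Properties using (length-++; length-map; length-mapMaybe; map-tabulate)
open import Data.List.Membership.Propositional using (_∈_; _∉_)
open import Data.List.Membership.Propositional.Properties
  using (∈-allFin; ∈-filter⁺; ∈-map⁺; ∈-++⁺ˡ; ∈-++⁺ʳ)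
import Data.List.Relation.Unary.Any as Any
open import Data.List.Relation.Unary.Any using (here; there; index)
open import Data.List.Relation.Unary.Any.Properties using (lookup-index; mapMaybe⁺; map⁺)
open import Data.Maybe using (Maybe; just; nothing)
import Data.Maybe.Relation.Unary.Any as Maybe
open import Data.Nat using (ℕ; zero; suc; _+_; _*_; _∸_; _≤_; _<_; _≤ᵇ_; _⊔_; _%_; z≤n; s≤s)
open import Data.Nat.DivMod using (%-distribˡ-+; m%n<n)
open import Data.Nat.Properties
  using ( +-0-commutativeMonoid; module ≤-Reasoning; ≤-trans; ≤-reflexive; <-≤-trans; ≤-<-trans
        ; ≰⇒>; <⇒≱; ≤ᵇ⇒≤; ≤⇒≤ᵇ; +-identityʳ; +-comm; +-suc; *-zeroʳ; *-suc; *-comm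
        ; +-mono-≤; +-monoˡ-≤; +-monoʳ-<; *-monoʳ-≤; +-cancelʳ-≤; *-cancelˡ-<
        ; m≤m+n; m≤n+m; m≤n+m∸n; m+n∸n≡m; m≤m⊔n; m≤n⊔m )
  renaming (_≟_ to _≟ℕ_)
open import Data.Nat.Tactic.RingSolver using (solve-∀)
open import Algebra.Properties.CommutativeMonoid.Sum +-0-commutativeMonoid
  using (sum-syntax; ∑-distrib-+; sum-cong-≗; sum-replicate-zero)
open import Data.Product using (∃; ∃₂; _×_; _,_; proj₁; proj₂)
open import Function using (_∘_; id; Equivalence)
open import Relation.Nullary using (¬_; yes; no; contradiction)
open import Relation.Nullary.Decidable using (¬?; _×-dec_)
open import Relation.Binary.PropositionalEquality
  using (_≡_; _≢_; refl; sym; trans; cong; cong₂; subst; subst₂; module ≡-Reasoning)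

private
  variable
    A B : Set
    n m : ℕ

⟦_⟧ : Bool → ℕ
⟦ true ⟧  = 1
⟦ false ⟧ = 0

eqᵇ-refl : (u : Fin n) → eqᵇ u u ≡ true
eqᵇ-refl u with u ≟ u
... | yes _   = refl
... | no u≢u = contradiction refl u≢u

eqᵇ-≢ : {u v : Fin n} → u ≢ v → eqᵇ u v ≡ false
eqᵇ-≢ {u = u} {v} u≢v with u ≟ v
... | yes u≡v = contradiction u≡v u≢v
... | no _    = refl

eqᵇ⇒≡ : {u v : Fin n} → eqᵇ u v ≡ true → u ≡ v
eqᵇ⇒≡ {u = u} {v} e with u ≟ v
... | yes u≡v = u≡v

-- Counting vertices

count : (A → Bool) → List A → ℕ
count p xs = length (filter (λ x → p x Bool.≟ true) xs)

members : (Fin n → Bool) → List (Fin n)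
members {n} p = filter (λ u → p u Bool.≟ true) (allFin n)

∈-members : {p : Fin n → Bool} {u : Fin n} → p u ≡ true → u ∈ members p
∈-members {p = p} {u} pu = ∈-filter⁺ (λ u → p u Bool.≟ true) (∈-allFin u) pu

count-∷ : (p : A → Bool) (x : A) (xs : List A) → count p (x ∷ xs) ≡ ⟦ p x ⟧ + count p xs
count-∷ p x xs with p x
... | true  = refl
... | false = refl

count-map : (p : B → Bool) (f : A → B) (xs : List A) → count p (map f xs) ≡ count (p ∘ f) xs
count-map p f [] = refl
count-map p f (x ∷ xs) = begin
  count p (f x ∷ map f xs)          ≡⟨ count-∷ p (f x) (map f xs) ⟩
  ⟦ p (f x) ⟧ + count p (map f xs)  ≡⟨ cong (⟦ p (f x) ⟧ +_) (count-map p f xs) ⟩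
  ⟦ p (f x) ⟧ + count (p ∘ f) xs    ≡⟨ count-∷ (p ∘ f) x xs ⟨
  count (p ∘ f) (x ∷ xs)            ∎
  where open ≡-Reasoning

countV-suc : (p : Fin (suc n) → Bool) → countV p ≡ ⟦ p zero ⟧ + countV (p ∘ suc)
countV-suc {n} p = begin
  count p (zero ∷ tabulate suc)        ≡⟨ count-∷ p zero (tabulate suc) ⟩
  ⟦ p zero ⟧ + count p (tabulate suc)  ≡⟨ cong (λ xs → ⟦ p zero ⟧ + count p xs) (map-tabulate id suc) ⟨
  ⟦ p zero ⟧ + count p (map suc (allFin n)) ≡⟨ cong (⟦ p zero ⟧ +_) (count-map p suc (allFin n)) ⟩
  ⟦ p zero ⟧ + countV (p ∘ suc)        ∎
  where open ≡-Reasoning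

countV-sum : (p : Fin n → Bool) → countV p ≡ ∑[ u < n ] ⟦ p u ⟧
countV-sum {zero}  p = refl
countV-sum {suc n} p = trans (countV-suc p) (cong (⟦ p zero ⟧ +_) (countV-sum (p ∘ suc)))

countV-cong : {p q : Fin n → Bool} → (∀ u → p u ≡ q u) → countV p ≡ countV q
countV-cong {p = p} {q} p≗q =
  trans (countV-sum p) (trans (sum-cong-≗ (cong ⟦_⟧ ∘ p≗q)) (sym (countV-sum q)))

countV-+ : {r p q : Fin n → Bool} → (∀ u → ⟦ r u ⟧ ≡ ⟦ p u ⟧ + ⟦ q u ⟧) →
           countV r ≡ countV p + countV q
countV-+ {r = r} {p} {q} r≗p+q = begin
  countV r                                 ≡⟨ countV-sum r ⟩
  ∑[ u < _ ] ⟦ r u ⟧                       ≡⟨ sum-cong-≗ r≗p+q ⟩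
  ∑[ u < _ ] (⟦ p u ⟧ + ⟦ q u ⟧)           ≡⟨ ∑-distrib-+ (⟦_⟧ ∘ p) (⟦_⟧ ∘ q) ⟩
  ∑[ u < _ ] ⟦ p u ⟧ + ∑[ u < _ ] ⟦ q u ⟧  ≡⟨ cong₂ _+_ (countV-sum p) (countV-sum q) ⟨
  countV p + countV q                      ∎
  where open ≡-Reasoning

countV-split : (p q : Fin n → Bool) →
               countV q ≡ countV (λ u → p u ∧ q u) + countV (λ u → not (p u) ∧ q u)
countV-split p q = countV-+ (λ u → split (p u) (q u))
  where
  split : ∀ a b → ⟦ b ⟧ ≡ ⟦ a ∧ b ⟧ + ⟦ not a ∧ b ⟧
  split true  b = sym (+-identityʳ ⟦ b ⟧)
  split false b = refl

countV-none : (p : Fin n → Bool) → (∀ u → p u ≡ false) → countV p ≡ 0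
countV-none {n} p p≗false =
  trans (countV-sum p) (trans (sum-cong-≗ (cong ⟦_⟧ ∘ p≗false)) (sum-replicate-zero n))

countV-single : (p : Fin n → Bool) (v : Fin n) → (∀ u → p u ≡ true → u ≡ v) →
                countV p ≡ ⟦ p v ⟧
countV-single {suc n} p zero only = begin
  countV p                       ≡⟨ countV-suc p ⟩
  ⟦ p zero ⟧ + countV (p ∘ suc)  ≡⟨ cong (⟦ p zero ⟧ +_) (countV-none (p ∘ suc) off-zero) ⟩
  ⟦ p zero ⟧ + 0                 ≡⟨ +-identityʳ _ ⟩
  ⟦ p zero ⟧                     ∎
  where
  open ≡-Reasoning
  off-zero : ∀ u → p (suc u) ≡ false
  off-zero u = ¬-not (0≢1+n ∘ sym ∘ only (suc u))
countV-single {suc n} p (suc v) only = begin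
  countV p                       ≡⟨ countV-suc p ⟩
  ⟦ p zero ⟧ + countV (p ∘ suc)  ≡⟨ cong₂ _+_ (cong ⟦_⟧ (¬-not (0≢1+n ∘ only zero)))
                                             (countV-single (p ∘ suc) v (λ u → suc-injective ∘ only (suc u))) ⟩
  ⟦ p (suc v) ⟧                  ∎
  where open ≡-Reasoning

countV-remove : (q : Fin n → Bool) (v : Fin n) →
              countV q ≡ ⟦ q v ⟧ + countV (λ u → not (eqᵇ u v) ∧ q u)
countV-remove q v =
  trans (countV-split (λ u → eqᵇ u v) q) (cong (_+ countV (λ u → not (eqᵇ u v) ∧ q u)) at-v)
  where
  only-v : ∀ u → (eqᵇ u v ∧ q u) ≡ true → u ≡ v
  only-v u e with eqᵇ u v in u≟v
  ... | true = eqᵇ⇒≡ u≟v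
  at-v : countV (λ u → eqᵇ u v ∧ q u) ≡ ⟦ q v ⟧
  at-v = trans (countV-single _ v only-v) (cong (λ b → ⟦ b ∧ q v ⟧) (eqᵇ-refl v))

countV-remove₂ : {v₁ v₂ : Fin n} → v₁ ≢ v₂ → (q : Fin n → Bool) →
  countV q ≡ ⟦ q v₁ ⟧ + (⟦ q v₂ ⟧ + countV (λ u → not (eqᵇ u v₁ ∨ eqᵇ u v₂) ∧ q u))
countV-remove₂ {v₁ = v₁} {v₂} v₁≢v₂ q = begin
  countV q
    ≡⟨ countV-remove q v₁ ⟩
  ⟦ q v₁ ⟧ + countV (λ u → not (eqᵇ u v₁) ∧ q u)
    ≡⟨ cong (⟦ q v₁ ⟧ +_) (countV-remove _ v₂) ⟩
  ⟦ q v₁ ⟧ + (⟦ not (eqᵇ v₂ v₁) ∧ q v₂ ⟧ + countV (λ u → not (eqᵇ u v₂) ∧ (not (eqᵇ u v₁) ∧ q u)))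
    ≡⟨ cong (λ b → ⟦ q v₁ ⟧ + (⟦ not b ∧ q v₂ ⟧ + others)) (eqᵇ-≢ (v₁≢v₂ ∘ sym)) ⟩
  ⟦ q v₁ ⟧ + (⟦ q v₂ ⟧ + countV (λ u → not (eqᵇ u v₂) ∧ (not (eqᵇ u v₁) ∧ q u)))
    ≡⟨ cong (λ c → ⟦ q v₁ ⟧ + (⟦ q v₂ ⟧ + c)) (countV-cong (λ u → merge (eqᵇ u v₁) (eqᵇ u v₂) (q u))) ⟩
  ⟦ q v₁ ⟧ + (⟦ q v₂ ⟧ + countV (λ u → not (eqᵇ u v₁ ∨ eqᵇ u v₂) ∧ q u))
    ∎
  where
  open ≡-Reasoning
  others : ℕ
  others = countV (λ u → not (eqᵇ u v₂) ∧ (not (eqᵇ u v₁) ∧ q u))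
  merge : ∀ a b c → (not b ∧ (not a ∧ c)) ≡ (not (a ∨ b) ∧ c)
  merge true  true  c = refl
  merge true  false c = refl
  merge false true  c = refl
  merge false false c = refl

countV-markov : (k : ℕ) (f : Fin m → ℕ) → k * countV (λ a → k ≤ᵇ f a) ≤ ∑[ a < m ] f a
countV-markov {zero}  k f = ≤-reflexive (*-zeroʳ k)
countV-markov {suc m} k f rewrite countV-suc (λ a → k ≤ᵇ f a) with k ≤ᵇ f zero in k≤f₀
... | true  = ≤-trans (≤-reflexive (*-suc k _))
                      (+-mono-≤ (≤ᵇ⇒≤ k (f zero) (Equivalence.from T-≡ k≤f₀)) (countV-markov k (f ∘ suc)))
... | false = ≤-trans (countV-markov k (f ∘ suc)) (m≤n+m _ (f zero))

length<⇒∃∉ : (F : List (Fin m)) → length F < m → ∃ λ x → x ∉ F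
length<⇒∃∉ {m} F |F|<m = ¬∀⟶∃¬ m (_∈ F) (λ x → Any.any? (x ≟_) F) not-all
  where
  not-all : ¬ (∀ x → x ∈ F)
  not-all all with i , j , i<j , same ← pigeonhole |F|<m (index ∘ all) =
    <⇒≢ i<j (trans (lookup-index (all i)) (trans (cong (lookup F) same) (sym (lookup-index (all j)))))

∈-mapMaybe⁺ : {f : A → Maybe B} {x : A} {y : B} {xs : List A} →
              x ∈ xs → f x ≡ just y → y ∈ mapMaybe f xs
∈-mapMaybe⁺ {f = f} {xs = xs} x∈xs fx≡y =
  mapMaybe⁺ f xs (map⁺ (Any.map (λ { refl → subst (Maybe.Any _) (sym fx≡y) (Maybe.just refl) }) x∈xs))

consIf : Bool → A → List A → List A
consIf true  x xs = x ∷ xs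
consIf false x xs = xs

length-consIf : ∀ b (x : A) xs → length (consIf b x xs) ≡ ⟦ b ⟧ + length xs
length-consIf true  x xs = refl
length-consIf false x xs = refl

∈-consIf⁺ : ∀ b {x y : A} {xs} → y ∈ xs → y ∈ consIf b x xs
∈-consIf⁺ true  y∈xs = there y∈xs
∈-consIf⁺ false y∈xs = y∈xs

-- Choosing two colours

partners : Fin m → List (Fin m × Fin m) → List (Fin m)
partners a []            = []
partners a ((x , y) ∷ E) = consIf (eqᵇ a x) y (consIf (eqᵇ a y) x (partners a E))

degree : Fin m → List (Fin m × Fin m) → ℕ
degree a E = length (partners a E)

∈-partners⁺ˡ : {a b : Fin m} {E : List (Fin m × Fin m)} → (a , b) ∈ E → b ∈ partners a E
∈-partners⁺ˡ {a = a} (here refl) rewrite eqᵇ-refl a = here refl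
∈-partners⁺ˡ {a = a} {E = (x , y) ∷ _} (there ab∈E) =
  ∈-consIf⁺ (eqᵇ a x) (∈-consIf⁺ (eqᵇ a y) (∈-partners⁺ˡ ab∈E))

∈-partners⁺ʳ : {a b : Fin m} {E : List (Fin m × Fin m)} → (b , a) ∈ E → b ∈ partners a E
∈-partners⁺ʳ {a = a} (here refl) rewrite eqᵇ-refl a = ∈-consIf⁺ _ (here refl)
∈-partners⁺ʳ {a = a} {E = (x , y) ∷ _} (there ba∈E) =
  ∈-consIf⁺ (eqᵇ a x) (∈-consIf⁺ (eqᵇ a y) (∈-partners⁺ʳ ba∈E))

∑-degree : (E : List (Fin m × Fin m)) → ∑[ a < m ] degree a E ≡ 2 * length E
∑-degree {m} []            = sum-replicate-zero m
∑-degree {m} ((x , y) ∷ E) = begin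
  ∑[ a < m ] degree a ((x , y) ∷ E)
    ≡⟨ sum-cong-≗ length-partners-∷ ⟩
  ∑[ a < m ] (⟦ eqᵇ a x ⟧ + (⟦ eqᵇ a y ⟧ + degree a E))
    ≡⟨ ∑-distrib-+ (λ a → ⟦ eqᵇ a x ⟧) _ ⟩
  ∑[ a < m ] ⟦ eqᵇ a x ⟧ + ∑[ a < m ] (⟦ eqᵇ a y ⟧ + degree a E)
    ≡⟨ cong (∑[ a < m ] ⟦ eqᵇ a x ⟧ +_) (∑-distrib-+ (λ a → ⟦ eqᵇ a y ⟧) _) ⟩
  ∑[ a < m ] ⟦ eqᵇ a x ⟧ + (∑[ a < m ] ⟦ eqᵇ a y ⟧ + ∑[ a < m ] degree a E)
    ≡⟨ cong₂ (λ i j → i + (j + ∑[ a < m ] degree a E)) (∑-indicator x) (∑-indicator y) ⟩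
  2 + ∑[ a < m ] degree a E
    ≡⟨ cong (2 +_) (∑-degree E) ⟩
  2 + 2 * length E
    ≡⟨ *-suc 2 (length E) ⟨
  2 * length ((x , y) ∷ E)
    ∎
  where
  open ≡-Reasoning
  length-partners-∷ : ∀ a → degree a ((x , y) ∷ E) ≡ ⟦ eqᵇ a x ⟧ + (⟦ eqᵇ a y ⟧ + degree a E)
  length-partners-∷ a = trans (length-consIf (eqᵇ a x) y (consIf (eqᵇ a y) x (partners a E)))
                              (cong (⟦ eqᵇ a x ⟧ +_) (length-consIf (eqᵇ a y) x (partners a E)))
  ∑-indicator : ∀ z → ∑[ a < m ] ⟦ eqᵇ a z ⟧ ≡ 1
  ∑-indicator z = begin
    ∑[ a < m ] ⟦ eqᵇ a z ⟧  ≡⟨ countV-sum (λ a → eqᵇ a z) ⟨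
    countV (λ a → eqᵇ a z)  ≡⟨ countV-single (λ a → eqᵇ a z) z (λ _ → eqᵇ⇒≡) ⟩
    ⟦ eqᵇ z z ⟧             ≡⟨ cong ⟦_⟧ (eqᵇ-refl z) ⟩
    1                       ∎

choose-colours : (F₁ F₂ : List (Fin m)) (E : List (Fin m × Fin m)) (p : ℕ) →
  length F₁ + p ≤ m → length F₂ + p ≤ m → 2 * length E < p * (p ∸ 1) →
  ∃₂ λ a b → a ∉ F₁ × b ∉ F₂ × a ≢ b × (a , b) ∉ E × (b , a) ∉ E
choose-colours {m} F₁ F₂ E p F₁-fits F₂-fits E-small =
  a , b , a∉F₁ , b∉F₂ , a≢b , ab∉E , ba∉E
  where
  heavy : Fin m → Bool
  heavy a = p ∸ 1 ≤ᵇ degree a E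
  few-heavy : countV heavy < p
  few-heavy = *-cancelˡ-< (p ∸ 1) (countV heavy) p (begin-strict
    (p ∸ 1) * countV heavy  ≤⟨ countV-markov (p ∸ 1) (λ a → degree a E) ⟩
    ∑[ a < m ] degree a E   ≡⟨ ∑-degree E ⟩
    2 * length E            <⟨ E-small ⟩
    p * (p ∸ 1)             ≡⟨ *-comm p (p ∸ 1) ⟩
    (p ∸ 1) * p             ∎)
    where open ≤-Reasoning
  a-exists = length<⇒∃∉ (F₁ ++ members heavy)
    (<-≤-trans (≤-<-trans (≤-reflexive (length-++ F₁)) (+-monoʳ-< (length F₁) few-heavy)) F₁-fits)
  a = proj₁ a-exists
  a∉F₁ : a ∉ F₁
  a∉F₁ = proj₂ a-exists ∘ ∈-++⁺ˡ
  a-light : suc (degree a E) < p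
  a-light = light p (λ le → proj₂ a-exists (∈-++⁺ʳ F₁ (∈-members (Equivalence.to T-≡ (≤⇒≤ᵇ le)))))
    where
    light : ∀ p → ¬ (p ∸ 1 ≤ degree a E) → suc (degree a E) < p
    light zero          ¬le = contradiction z≤n ¬le
    light (suc zero)    ¬le = contradiction z≤n ¬le
    light (suc (suc p)) ¬le = s≤s (≰⇒> ¬le)
  b-exists = length<⇒∃∉ (F₂ ++ a ∷ partners a E)
    (<-≤-trans (≤-<-trans (≤-reflexive (length-++ F₂)) (+-monoʳ-< (length F₂) a-light)) F₂-fits)
  b = proj₁ b-exists
  b∉F₂ : b ∉ F₂
  b∉F₂ = proj₂ b-exists ∘ ∈-++⁺ˡ
  a≢b : a ≢ b
  a≢b a≡b = proj₂ b-exists (∈-++⁺ʳ F₂ (here (sym a≡b)))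
  b∉partners : b ∉ partners a E
  b∉partners = proj₂ b-exists ∘ ∈-++⁺ʳ F₂ ∘ there
  ab∉E : (a , b) ∉ E
  ab∉E = b∉partners ∘ ∈-partners⁺ˡ
  ba∉E : (b , a) ∉ E
  ba∉E = b∉partners ∘ ∈-partners⁺ʳ

-- Parity of colour counts

Odd : ℕ → Set
Odd k = k % 2 ≡ 1

odd-suc : {k : ℕ} → ¬ Odd k → Odd (suc k)
odd-suc {k} ¬odd with k % 2 | m%n<n k 2 | %-distribˡ-+ 1 k 2
... | 0 | _ | 1+k%2 = 1+k%2
... | 1 | _ | _     = contradiction refl ¬odd
... | suc (suc _) | s≤s (s≤s ()) | _

data OddColours (N : Fin m → ℕ) : Set where
  none : (∀ i → ¬ Odd (N i)) → OddColours N
  one  : ∀ x → Odd (N x) → (∀ i → i ≢ x → ¬ Odd (N i)) → OddColours N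
  two  : ∀ x y → x ≢ y → Odd (N x) → Odd (N y) → OddColours N

oddColours : (N : Fin m → ℕ) → OddColours N
oddColours N with any? (λ x → N x % 2 ≟ℕ 1)
... | no ∄odd = none (λ i odd → ∄odd (i , odd))
... | yes (x , odd-x) with any? (λ y → ¬? (y ≟ x) ×-dec (N y % 2 ≟ℕ 1))
...   | yes (y , y≢x , odd-y) = two x y (y≢x ∘ sym) odd-x odd-y
...   | no ∄other             = one x odd-x (λ i i≢x odd-i → ∄other (i , i≢x , odd-i))

soleOdd : {N : Fin m → ℕ} → OddColours N → Maybe (Fin m)
soleOdd (one x _ _) = just x
soleOdd _           = nothing

oddPair : {N : Fin m → ℕ} → OddColours N → Maybe (Fin m × Fin m)
oddPair (two x y _ _ _) = just (x , y)
oddPair _               = nothing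

odd-unchanged : {a i : Fin m} {k : ℕ} → a ≢ i → Odd k → Odd (⟦ eqᵇ a i ⟧ + k)
odd-unchanged a≢i odd rewrite eqᵇ-≢ a≢i = odd

odd-flipped : (a : Fin m) {k : ℕ} → ¬ Odd k → Odd (⟦ eqᵇ a a ⟧ + k)
odd-flipped a {k} ¬odd rewrite eqᵇ-refl a = odd-suc {k} ¬odd

even-unchanged : {a i : Fin m} {k : ℕ} → a ≢ i → ¬ Odd k → ¬ Odd (⟦ eqᵇ a i ⟧ + k)
even-unchanged a≢i even rewrite eqᵇ-≢ a≢i = even

odd-after-adding : {N : Fin m → ℕ} (oc : OddColours N) (a : Fin m) →
  soleOdd oc ≢ just a → ∃ λ i → Odd (⟦ eqᵇ a i ⟧ + N i)
odd-after-adding (none even) a _ = a , odd-flipped a (even a)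
odd-after-adding (one x odd-x _) a sole≢a =
  x , odd-unchanged (λ a≡x → sole≢a (cong just (sym a≡x))) odd-x
odd-after-adding (two x y x≢y odd-x odd-y) a _ with a ≟ x
... | yes refl = y , odd-unchanged x≢y odd-y
... | no a≢x   = x , odd-unchanged a≢x odd-x

odd-after-adding-two : {N : Fin m → ℕ} (oc : OddColours N) {a b : Fin m} → a ≢ b →
  oddPair oc ≢ just (a , b) → oddPair oc ≢ just (b , a) →
  ∃ λ i → Odd (⟦ eqᵇ a i ⟧ + (⟦ eqᵇ b i ⟧ + N i))
odd-after-adding-two (none even) {a} a≢b _ _ =
  a , odd-flipped a (even-unchanged (a≢b ∘ sym) (even a))
odd-after-adding-two (one x odd-x even) {a} {b} a≢b _ _ with a ≟ x | b ≟ x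
... | yes refl | _        = b , odd-unchanged a≢b (odd-flipped b (even b (a≢b ∘ sym)))
... | no a≢x   | yes refl = a , odd-flipped a (even-unchanged (a≢b ∘ sym) (even a a≢x))
... | no a≢x   | no b≢x   = x , odd-unchanged a≢x (odd-unchanged b≢x odd-x)
odd-after-adding-two (two x y x≢y odd-x odd-y) {a} {b} a≢b ab≢ ba≢ with a ≟ x | b ≟ x
... | no a≢x   | no b≢x   = x , odd-unchanged a≢x (odd-unchanged b≢x odd-x)
... | yes refl | _        =
  y , odd-unchanged x≢y (odd-unchanged (λ b≡y → ab≢ (cong (λ z → just (x , z)) (sym b≡y))) odd-y)
... | no a≢x   | yes refl =
  y , odd-unchanged (λ a≡y → ba≢ (cong (λ z → just (x , z)) (sym a≡y))) (odd-unchanged x≢y odd-y)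

-- Arithmetic of the colour budget

searchFrom-sound : ∀ x f c → T (threeHalvesOK x (c + f)) → T (threeHalvesOK x (searchFrom x f c))
searchFrom-sound x zero    c ok = subst (T ∘ threeHalvesOK x) (+-identityʳ c) ok
searchFrom-sound x (suc f) c ok with threeHalvesOK x c in ok-c
... | true  = Equivalence.from T-≡ ok-c
... | false = searchFrom-sound x f (suc c) (subst (T ∘ threeHalvesOK x) (+-suc c f) ok)

ceilThreeHalvesPlusSqrt-sound : ∀ x → T (threeHalvesOK x (ceilThreeHalvesPlusSqrt x))
ceilThreeHalvesPlusSqrt-sound x = searchFrom-sound x (x + 3) 0
  (Equivalence.from T-∧ (≤⇒≤ᵇ three≤ , ≤⇒≤ᵇ square-large))
  where
  double : ∀ x → 2 * (x + 3) ≡ 2 * x + 3 + 3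
  double = solve-∀
  expand : ∀ x → (2 * x + 3) * (2 * x + 3) ≡ 4 * x + (4 * (x * x) + 8 * x + 9)
  expand = solve-∀
  three≤ : 3 ≤ 2 * (x + 3)
  three≤ = ≤-trans (m≤n+m 3 (2 * x + 3)) (≤-reflexive (sym (double x)))
  square-large : 4 * x ≤ (2 * (x + 3) ∸ 3) * (2 * (x + 3) ∸ 3)
  square-large rewrite double x | m+n∸n≡m (2 * x + 3) 3 =
    ≤-trans (m≤m+n (4 * x) _) (≤-reflexive (sym (expand x)))

threeHalvesOK⇒1≤ : ∀ x s → T (threeHalvesOK x s) → 1 ≤ s
threeHalvesOK⇒1≤ x (suc s) _ = s≤s z≤n

-- With s = q + 2 the condition reads 4(2t + 1) ≤ (2q + 1)² = 4q(q + 1) + 1, forcing q(q + 1) > 2t.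
threeHalvesOK⇒2t< : ∀ t s → T (threeHalvesOK (2 * suc (suc t) ∸ 3) s) →
                    2 * t < (s ∸ 1) * (s ∸ 1 ∸ 1)
threeHalvesOK⇒2t< t (suc (suc q)) ok = ≰⇒> λ qq≤2t → <⇒≱ (too-small qq≤2t) square-large
  where
  double : ∀ r → 2 * suc (suc r) ≡ suc (2 * r) + 3
  double = solve-∀
  odd-part : ∀ r → 2 * suc (suc r) ∸ 3 ≡ suc (2 * r)
  odd-part r = trans (cong (_∸ 3) (double r)) (m+n∸n≡m (suc (2 * r)) 3)
  square : ∀ q → suc (2 * q) * suc (2 * q) ≡ suc (4 * (suc q * q))
  square = solve-∀
  square-large : 4 * suc (2 * t) ≤ suc (2 * q) * suc (2 * q)
  square-large = subst₂ (λ a b → 4 * a ≤ b * b) (odd-part t) (odd-part q)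
                   (≤ᵇ⇒≤ _ _ (proj₂ (Equivalence.to T-∧ ok)))
  too-small : suc q * q ≤ 2 * t → suc (2 * q) * suc (2 * q) < 4 * suc (2 * t)
  too-small qq≤2t = begin-strict
    suc (2 * q) * suc (2 * q)  ≡⟨ square q ⟩
    suc (4 * (suc q * q))      ≤⟨ s≤s (*-monoʳ-≤ 4 qq≤2t) ⟩
    suc (4 * (2 * t))          <⟨ s≤s (s≤s (m≤n+m _ 2)) ⟩
    4 + 4 * (2 * t)            ≡⟨ *-suc 4 (2 * t) ⟨
    4 * suc (2 * t)            ∎
    where open ≤-Reasoning

budget-fits : ∀ f t Δ s {m} → f + suc t ≤ 2 * Δ → 2 * Δ ∸ suc (suc t) + s ≤ m → 1 ≤ s →
              f + (s ∸ 1) ≤ m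
budget-fits f t Δ (suc s) {m} f-small m-large _ = begin
  f + s          ≤⟨ +-monoˡ-≤ s f≤1+slack ⟩
  suc slack + s  ≡⟨ +-suc slack s ⟨
  slack + suc s  ≤⟨ m-large ⟩
  m              ∎
  where
  open ≤-Reasoning
  slack = 2 * Δ ∸ suc (suc t)
  f≤1+slack : f ≤ suc slack
  f≤1+slack = +-cancelʳ-≤ (suc t) f (suc slack) (begin
    f + suc t                ≤⟨ f-small ⟩
    2 * Δ                    ≤⟨ m≤n+m∸n (2 * Δ) (suc (suc t)) ⟩
    suc (suc t) + slack      ≡⟨ cong (2 +_) (+-comm t slack) ⟩
    suc (suc (slack + t))    ≡⟨ +-suc (suc slack) t ⟨
    suc slack + suc t        ∎)

≤-foldr-⊔ : {x : ℕ} {xs : List ℕ} → x ∈ xs → x ≤ foldr _⊔_ 0 xs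
≤-foldr-⊔ (here refl)                = m≤m⊔n _ _
≤-foldr-⊔ {xs = y ∷ _} (there x∈xs) = ≤-trans (≤-foldr-⊔ x∈xs) (m≤n⊔m y _)

deg≤maxDeg : (G : Graph n) (v : Fin n) → deg G v ≤ maxDeg G
deg≤maxDeg G v = ≤-foldr-⊔ (∈-map⁺ (deg G) (∈-allFin v))

-- Extending an odd colouring of G − {v₁, v₂}

no-loop : (G : Graph n) (v : Fin n) → adj G v v ≢ true
no-loop G v v~v = contradiction (trans (sym v~v) (irrefl G v)) λ ()

module Extension {n m : ℕ} (G : Graph n) (v₁ v₂ : Fin n) (v₁~v₂ : adj G v₁ v₂ ≡ true)
                 (c′ : Fin n → Fin m) where

  adj-sym : ∀ {u v b} → adj G u v ≡ b → adj G v u ≡ b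
  adj-sym {u} {v} = trans (Graph.sym G v u)

  v₁≢v₂ : v₁ ≢ v₂
  v₁≢v₂ refl = no-loop G v₁ v₁~v₂

  v₂~v₁ : adj G v₂ v₁ ≡ true
  v₂~v₁ = adj-sym v₁~v₂

  rest : Fin n → Bool
  rest u = not (eqᵇ u v₁ ∨ eqᵇ u v₂)

  data Location : Fin n → Set where
    at-v₁   : Location v₁
    at-v₂   : Location v₂
    in-rest : ∀ {u} → rest u ≡ true → Location u

  locate : ∀ u → Location u
  locate u with u ≟ v₁ | u ≟ v₂
  ... | yes refl | _        = at-v₁
  ... | no _     | yes refl = at-v₂
  ... | no u≢v₁  | no u≢v₂  = in-rest (cong₂ (λ x y → not (x ∨ y)) (eqᵇ-≢ u≢v₁) (eqᵇ-≢ u≢v₂))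

  rest-of-non-neighbour : ∀ {u} → adj G u v₁ ≡ false → adj G u v₂ ≡ false → rest u ≡ true
  rest-of-non-neighbour {u} ¬u~v₁ ¬u~v₂ with locate u
  ... | at-v₁      = contradiction (trans (sym v₁~v₂) ¬u~v₂) λ ()
  ... | at-v₂      = contradiction (trans (sym v₂~v₁) ¬u~v₁) λ ()
  ... | in-rest ru = ru

  degIn-non-neighbour : ∀ {u} → adj G u v₁ ≡ false → adj G u v₂ ≡ false →
                        degIn G (λ _ → true) u ≡ degIn G rest u
  degIn-non-neighbour {u} ¬u~v₁ ¬u~v₂ = trans (countV-remove₂ v₁≢v₂ (adj G u))
    (cong₂ (λ x y → ⟦ x ⟧ + (⟦ y ⟧ + degIn G rest u)) ¬u~v₁ ¬u~v₂)

  common : ℕ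
  common = countV (λ u → adj G v₁ u ∧ adj G v₂ u)

  commonClosed≡ : commonClosed G v₁ v₂ ≡ suc (suc common)
  commonClosed≡ = begin
    commonClosed G v₁ v₂
      ≡⟨ countV-remove₂ v₁≢v₂ closed ⟩
    ⟦ closed v₁ ⟧ + (⟦ closed v₂ ⟧ + countV (λ u → rest u ∧ closed u))
      ≡⟨ cong₂ (λ x y → ⟦ x ⟧ + (⟦ y ⟧ + countV (λ u → rest u ∧ closed u))) closed-v₁ closed-v₂ ⟩
    2 + countV (λ u → rest u ∧ closed u)
      ≡⟨ cong (2 +_) (countV-cong closed≗both) ⟩
    2 + countV (λ u → rest u ∧ both u)
      ≡⟨ cong (2 +_) common≡ ⟨
    2 + common
      ∎
    where
    open ≡-Reasoning
    closed both : Fin n → Bool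
    closed u = closedNbhd G v₁ u ∧ closedNbhd G v₂ u
    both u = adj G v₁ u ∧ adj G v₂ u
    closed-v₁ : closed v₁ ≡ true
    closed-v₁ rewrite eqᵇ-refl v₁ | eqᵇ-≢ v₁≢v₂ | v₂~v₁ = refl
    closed-v₂ : closed v₂ ≡ true
    closed-v₂ rewrite eqᵇ-≢ (v₁≢v₂ ∘ sym) | v₁~v₂ | eqᵇ-refl v₂ = refl
    closed≗both : ∀ u → (rest u ∧ closed u) ≡ (rest u ∧ both u)
    closed≗both u with eqᵇ u v₁ | eqᵇ u v₂
    ... | true  | _     = refl
    ... | false | true  = refl
    ... | false | false = refl
    both-v₁ : both v₁ ≡ false
    both-v₁ rewrite irrefl G v₁ = refl
    both-v₂ : both v₂ ≡ false
    both-v₂ rewrite v₁~v₂ | irrefl G v₂ = refl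
    common≡ : common ≡ countV (λ u → rest u ∧ both u)
    common≡ = trans (countV-remove₂ v₁≢v₂ both)
      (cong₂ (λ x y → ⟦ x ⟧ + (⟦ y ⟧ + countV (λ u → rest u ∧ both u))) both-v₁ both-v₂)

  deg-v₁ : deg G v₁ ≡ suc (countV (λ u → rest u ∧ adj G v₁ u))
  deg-v₁ = trans (countV-remove₂ v₁≢v₂ (adj G v₁))
    (cong₂ (λ x y → ⟦ x ⟧ + (⟦ y ⟧ + countV (λ u → rest u ∧ adj G v₁ u))) (irrefl G v₁) v₁~v₂)

  deg-v₂ : deg G v₂ ≡ suc (countV (λ u → rest u ∧ adj G v₂ u))
  deg-v₂ = trans (countV-remove₂ v₁≢v₂ (adj G v₂))
    (cong₂ (λ x y → ⟦ x ⟧ + (⟦ y ⟧ + countV (λ u → rest u ∧ adj G v₂ u))) v₂~v₁ (irrefl G v₂))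

  N : Fin n → Fin m → ℕ
  N u = colourCountIn G rest c′ u

  oddColoursAt : (u : Fin n) → OddColours (N u)
  oddColoursAt u = oddColours (N u)

  Forbidden : Fin n → Fin n → List (Fin m)
  Forbidden v w = map c′ (members (λ u → rest u ∧ adj G v u))
               ++ mapMaybe (soleOdd ∘ oddColoursAt) (members (λ u → not (adj G w u) ∧ adj G v u))

  Conflicts : List (Fin m × Fin m)
  Conflicts = mapMaybe (oddPair ∘ oddColoursAt) (members (λ u → adj G v₁ u ∧ adj G v₂ u))

  colour∈Forbidden : ∀ {v w u} → rest u ≡ true → adj G v u ≡ true → c′ u ∈ Forbidden v w
  colour∈Forbidden ru v~u = ∈-++⁺ˡ (∈-map⁺ c′ (∈-members (cong₂ _∧_ ru v~u)))

  sole∈Forbidden : ∀ {v w u x} → adj G w u ≡ false → adj G v u ≡ true →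
                   soleOdd (oddColoursAt u) ≡ just x → x ∈ Forbidden v w
  sole∈Forbidden {v} {w} {u} ¬w~u v~u sole = ∈-++⁺ʳ (map c′ (members (λ u → rest u ∧ adj G v u)))
    (∈-mapMaybe⁺ {f = soleOdd ∘ oddColoursAt} {x = u}
      (∈-members {p = λ u → not (adj G w u) ∧ adj G v u} (cong₂ (λ x y → not x ∧ y) ¬w~u v~u)) sole)

  pair∈Conflicts : ∀ {u xy} → adj G v₁ u ≡ true → adj G v₂ u ≡ true →
                   oddPair (oddColoursAt u) ≡ just xy → xy ∈ Conflicts
  pair∈Conflicts {u} v₁~u v₂~u pair = ∈-mapMaybe⁺ {f = oddPair ∘ oddColoursAt} {x = u}
    (∈-members {p = λ u → adj G v₁ u ∧ adj G v₂ u} (cong₂ _∧_ v₁~u v₂~u)) pair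

  length-Forbidden : ∀ v w → deg G v ≡ suc (countV (λ u → rest u ∧ adj G v u)) →
    length (Forbidden v w) + suc (countV (λ u → adj G w u ∧ adj G v u)) ≤ 2 * deg G v
  length-Forbidden v w deg≡ = begin
    length (Forbidden v w) + suc c  ≤⟨ +-monoˡ-≤ (suc c) Forbidden≤ ⟩
    r + e + suc c                   ≡⟨ rearrange r e c ⟩
    suc r + (c + e)                 ≡⟨ cong₂ _+_ deg≡ (countV-split (adj G w) (adj G v)) ⟨
    deg G v + deg G v               ≡⟨ cong (deg G v +_) (+-identityʳ (deg G v)) ⟨
    2 * deg G v                     ∎
    where
    open ≤-Reasoning
    r = countV (λ u → rest u ∧ adj G v u)
    c = countV (λ u → adj G w u ∧ adj G v u)
    e = countV (λ u → not (adj G w u) ∧ adj G v u)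
    rearrange : ∀ r e c → r + e + suc c ≡ suc r + (c + e)
    rearrange = solve-∀
    Forbidden≤ : length (Forbidden v w) ≤ r + e
    Forbidden≤ = ≤-trans (≤-reflexive (length-++ (map c′ (members (λ u → rest u ∧ adj G v u)))))
      (+-mono-≤ (≤-reflexive (length-map c′ (members (λ u → rest u ∧ adj G v u))))
                (length-mapMaybe (soleOdd ∘ oddColoursAt) (members (λ u → not (adj G w u) ∧ adj G v u))))

  Forbidden-v₁ : length (Forbidden v₁ v₂) + suc common ≤ 2 * maxDeg G
  Forbidden-v₁ = begin
    length (Forbidden v₁ v₂) + suc common
      ≡⟨ cong (λ k → length (Forbidden v₁ v₂) + suc k)
              (countV-cong (λ u → ∧-comm (adj G v₁ u) (adj G v₂ u))) ⟩
    length (Forbidden v₁ v₂) + suc (countV (λ u → adj G v₂ u ∧ adj G v₁ u))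
      ≤⟨ length-Forbidden v₁ v₂ deg-v₁ ⟩
    2 * deg G v₁
      ≤⟨ *-monoʳ-≤ 2 (deg≤maxDeg G v₁) ⟩
    2 * maxDeg G
      ∎
    where open ≤-Reasoning

  Forbidden-v₂ : length (Forbidden v₂ v₁) + suc common ≤ 2 * maxDeg G
  Forbidden-v₂ = ≤-trans (length-Forbidden v₂ v₁ deg-v₂) (*-monoʳ-≤ 2 (deg≤maxDeg G v₂))

  length-Conflicts : length Conflicts ≤ common
  length-Conflicts = length-mapMaybe (oddPair ∘ oddColoursAt) (members (λ u → adj G v₁ u ∧ adj G v₂ u))

  extend : Fin m → Fin m → Fin n → Fin m
  extend a b u = if eqᵇ u v₁ then a else if eqᵇ u v₂ then b else c′ u

  extend-v₁ : ∀ a b → extend a b v₁ ≡ a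
  extend-v₁ a b rewrite eqᵇ-refl v₁ = refl

  extend-v₂ : ∀ a b → extend a b v₂ ≡ b
  extend-v₂ a b rewrite eqᵇ-≢ (v₁≢v₂ ∘ sym) | eqᵇ-refl v₂ = refl

  extend-rest : ∀ a b {u} → rest u ≡ true → extend a b u ≡ c′ u
  extend-rest a b {u} ru with eqᵇ u v₁ | eqᵇ u v₂
  ... | true  | _     = contradiction ru λ ()
  ... | false | true  = contradiction ru λ ()
  ... | false | false = refl

  module _ {a b : Fin m} (a∉ : a ∉ Forbidden v₁ v₂) (b∉ : b ∉ Forbidden v₂ v₁) (a≢b : a ≢ b)
           (ab∉ : (a , b) ∉ Conflicts) (ba∉ : (b , a) ∉ Conflicts)
           (c′-odd : IsOddColouringOn G rest m c′) where

    private
      c : Fin n → Fin m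
      c = extend a b

    proper-at : ∀ {u w} → Location u → Location w → adj G u w ≡ true → c u ≢ c w
    proper-at at-v₁ at-v₁ v₁~v₁ = ⊥-elim (no-loop G v₁ v₁~v₁)
    proper-at at-v₂ at-v₂ v₂~v₂ = ⊥-elim (no-loop G v₂ v₂~v₂)
    proper-at at-v₁ at-v₂ _ same = a≢b (trans (sym (extend-v₁ a b)) (trans same (extend-v₂ a b)))
    proper-at at-v₂ at-v₁ v₂~v₁ same = proper-at at-v₁ at-v₂ (adj-sym v₂~v₁) (sym same)
    proper-at at-v₁ (in-rest rw) v₁~w same = a∉ (subst (_∈ Forbidden v₁ v₂)
      (trans (sym (extend-rest a b rw)) (trans (sym same) (extend-v₁ a b))) (colour∈Forbidden rw v₁~w))
    proper-at at-v₂ (in-rest rw) v₂~w same = b∉ (subst (_∈ Forbidden v₂ v₁)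
      (trans (sym (extend-rest a b rw)) (trans (sym same) (extend-v₂ a b))) (colour∈Forbidden rw v₂~w))
    proper-at (in-rest ru) at-v₁ u~v₁ same = proper-at at-v₁ (in-rest ru) (adj-sym u~v₁) (sym same)
    proper-at (in-rest ru) at-v₂ u~v₂ same = proper-at at-v₂ (in-rest ru) (adj-sym u~v₂) (sym same)
    proper-at {u} {w} (in-rest ru) (in-rest rw) u~w same = proj₁ c′-odd u w ru rw u~w
      (trans (sym (extend-rest a b ru)) (trans same (extend-rest a b rw)))

    colourCountIn-extend : ∀ u i → colourCountIn G (λ _ → true) c u i
                                   ≡ ⟦ adj G u v₁ ∧ eqᵇ a i ⟧ + (⟦ adj G u v₂ ∧ eqᵇ b i ⟧ + N u i)
    colourCountIn-extend u i = begin
      countV (λ w → adj G u w ∧ eqᵇ (c w) i)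
        ≡⟨ countV-remove₂ v₁≢v₂ (λ w → adj G u w ∧ eqᵇ (c w) i) ⟩
      ⟦ adj G u v₁ ∧ eqᵇ (c v₁) i ⟧ + (⟦ adj G u v₂ ∧ eqᵇ (c v₂) i ⟧ + others)
        ≡⟨ cong₂ (λ x y → ⟦ adj G u v₁ ∧ eqᵇ x i ⟧ + (⟦ adj G u v₂ ∧ eqᵇ y i ⟧ + others))
                 (extend-v₁ a b) (extend-v₂ a b) ⟩
      ⟦ adj G u v₁ ∧ eqᵇ a i ⟧ + (⟦ adj G u v₂ ∧ eqᵇ b i ⟧ + others)
        ≡⟨ cong (λ k → ⟦ adj G u v₁ ∧ eqᵇ a i ⟧ + (⟦ adj G u v₂ ∧ eqᵇ b i ⟧ + k))
                (countV-cong on-rest) ⟩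
      ⟦ adj G u v₁ ∧ eqᵇ a i ⟧ + (⟦ adj G u v₂ ∧ eqᵇ b i ⟧ + N u i)
        ∎
      where
      open ≡-Reasoning
      others : ℕ
      others = countV (λ w → rest w ∧ (adj G u w ∧ eqᵇ (c w) i))
      on-rest : ∀ w → (rest w ∧ (adj G u w ∧ eqᵇ (c w) i)) ≡ (rest w ∧ (adj G u w ∧ eqᵇ (c′ w) i))
      on-rest w with rest w in rw
      ... | true  = cong (λ x → adj G u w ∧ eqᵇ x i) (extend-rest a b rw)
      ... | false = refl

    odd-at : ∀ u → 0 < degIn G (λ _ → true) u →
             ∃ λ i → Odd (⟦ adj G u v₁ ∧ eqᵇ a i ⟧ + (⟦ adj G u v₂ ∧ eqᵇ b i ⟧ + N u i))
    odd-at u deg>0 with adj G u v₁ in u~v₁ | adj G u v₂ in u~v₂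
    ... | false | false = proj₂ c′-odd u (rest-of-non-neighbour u~v₁ u~v₂)
                            (subst (0 <_) (degIn-non-neighbour u~v₁ u~v₂) deg>0)
    ... | true  | false = odd-after-adding (oddColoursAt u) a
                            (a∉ ∘ sole∈Forbidden (adj-sym u~v₂) (adj-sym u~v₁))
    ... | false | true  = odd-after-adding (oddColoursAt u) b
                            (b∉ ∘ sole∈Forbidden (adj-sym u~v₁) (adj-sym u~v₂))
    ... | true  | true  = odd-after-adding-two (oddColoursAt u) a≢b
                            (ab∉ ∘ pair∈Conflicts (adj-sym u~v₁) (adj-sym u~v₂))
                            (ba∉ ∘ pair∈Conflicts (adj-sym u~v₁) (adj-sym u~v₂))

    extend-isOddColouring : IsOddColouringOn G (λ _ → true) m c
    extend-isOddColouring =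
        (λ u w _ _ u~w → proper-at (locate u) (locate w) u~w)
      , (λ u _ deg>0 → let i , odd = odd-at u deg>0 in
                        i , subst Odd (sym (colourCountIn-extend u i)) odd)

lemma3p2 : {n : ℕ} (G : Graph n) (v₁ v₂ : Fin n) (m : ℕ) →
    3 ≤ maxDeg G →
    adj G v₁ v₂ ≡ true →
    2 * maxDeg G ∸ commonClosed G v₁ v₂ + ceilThreeHalvesPlusSqrt (2 * commonClosed G v₁ v₂ ∸ 3) ≤ m →
    OddColourableMinus2 G v₁ v₂ m →
    OddColourable G m
lemma3p2 G v₁ v₂ m _ v₁~v₂ m-large (c′ , c′-odd) =
  let a , b , a∉ , b∉ , a≢b , ab∉ , ba∉ =
        choose-colours (Forbidden v₁ v₂) (Forbidden v₂ v₁) Conflicts (s ∸ 1)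
          (budget-fits _ common (maxDeg G) s Forbidden-v₁ m-large′ s≥1)
          (budget-fits _ common (maxDeg G) s Forbidden-v₂ m-large′ s≥1)
          (≤-<-trans (*-monoʳ-≤ 2 length-Conflicts) (threeHalvesOK⇒2t< common s s-sound))
  in extend a b , extend-isOddColouring a∉ b∉ a≢b ab∉ ba∉ c′-odd
  where
  open Extension G v₁ v₂ v₁~v₂ c′
  s : ℕ
  s = ceilThreeHalvesPlusSqrt (2 * commonClosed G v₁ v₂ ∸ 3)
  s-sound : T (threeHalvesOK (2 * suc (suc common) ∸ 3) s)
  s-sound = subst (λ k → T (threeHalvesOK (2 * k ∸ 3) s)) commonClosed≡
                  (ceilThreeHalvesPlusSqrt-sound (2 * commonClosed G v₁ v₂ ∸ 3))
  s≥1 : 1 ≤ s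
  s≥1 = threeHalvesOK⇒1≤ (2 * suc (suc common) ∸ 3) s s-sound
  m-large′ : 2 * maxDeg G ∸ suc (suc common) + s ≤ m
  m-large′ = subst (λ k → 2 * maxDeg G ∸ k + s ≤ m) commonClosed≡ m-large
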